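{- Let $\Omega$ be a connected $k$-orbigraph with $n$ vertices and adjacency matrix $A$, let $P=\frac1kA$, and let $\pi=(\pi_1,\dots,\pi_n)$ be the stationary distribution of $P$ (i.e. $\pi P=\pi$, $\sum_i\pi_i=1$, $\pi_i\ge0$). If $\pi_m$ is a minimal entry of $\pi$, then $\pi_m\ge \dfrac{1}{nk^{n-1}}$.
   Context: A $k$-orbigraph is a finite weighted directed graph $\Omega$ (loops allowed) on vertices $1,\dots,n$ whose adjacency matrix $A$ ($A_{ij}$ = weight of the directed edge $(i,j)$, $0$ if absent) satisfies: $A_{ij}\in\mathbb{Z}_{\ge 0}$; $\sum_j A_{ij}=k$ for every $i$; and $A_{ij}>0$ iff $A_{ji}>0$. It is connected if its underlying graph is connected; a connected orbigraph is strongly connected, so $P$ has a unique stationary distribution. -}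

module Defs where

open import Data.Nat as ℕ using (ℕ; zero; suc; NonZero)
open import Data.Nat.Properties using (m*n≢0; m^n≢0)
open import Data.Fin using (Fin; zero; suc)
open import Data.Integer using (+_)
open import Data.Rational as ℚ using (ℚ; 0ℚ; _/_)
open import Data.Product using (Σ; _×_; _,_)
open import Relation.Binary.PropositionalEquality using (_≡_)

Matrix : ℕ → Set
Matrix n = Fin n → Fin n → ℕ

sumℕ : ∀ {n} → (Fin n → ℕ) → ℕ
sumℕ {zero}  f = 0
sumℕ {suc n} f = f zero ℕ.+ sumℕ (λ i → f (suc i))

sumℚ : ∀ {n} → (Fin n → ℚ) → ℚ
sumℚ {zero}  f = 0ℚ
sumℚ {suc n} f = f zero ℚ.+ sumℚ (λ i → f (suc i))

-- A is the adjacency matrix of a k-orbigraph: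
-- entries in ℤ≥0 (built in via ℕ), every row sums to k, and A i j > 0 iff A j i > 0.
IsOrbigraph : ∀ {n} → ℕ → Matrix n → Set
IsOrbigraph {n} k A =
  ((i : Fin n) → sumℕ (λ j → A i j) ≡ k) ×
  ((i j : Fin n) → 0 ℕ.< A i j → 0 ℕ.< A j i)

data Walk {n} (A : Matrix n) : Fin n → Fin n → Set where
  here : ∀ {i} → Walk A i i
  step : ∀ {i j l} → 0 ℕ.< A i j → Walk A j l → Walk A i l

Connected : ∀ {n} → Matrix n → Set
Connected {n} A = (i j : Fin n) → Walk A i j

P : ∀ {n} (k : ℕ) .{{_ : NonZero k}} → Matrix n → Fin n → Fin n → ℚ
P k A i j = + (A i j) / k

IsStationary : ∀ {n} (k : ℕ) .{{_ : NonZero k}} → Matrix n → (Fin n → ℚ) → Set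
IsStationary {n} k A π =
  ((j : Fin n) → sumℚ (λ i → π i ℚ.* P k A i j) ≡ π j) ×
  (sumℚ π ≡ ℚ.1ℚ) ×
  ((i : Fin n) → 0ℚ ℚ.≤ π i)

bound : (n k : ℕ) .{{nz : NonZero n}} .{{kz : NonZero k}} → ℚ
bound n k {{nz}} {{kz}} = _/_ (+ 1) (n ℕ.* k ℕ.^ (n ℕ.∸ 1))
  {{m*n≢0 n (k ℕ.^ (n ℕ.∸ 1)) {{nz}} {{m^n≢0 k (n ℕ.∸ 1) {{kz}}}}}}

-- A stationary π satisfies π j = Σᵢ π i A i j / k ≥ π i / k along every edge i → j, so
-- π i ≤ k ^ L * π m whenever a walk of length L leads from i to m. In a connected graph every
-- vertex reaches m by a path, which visits distinct vertices and so has length at most n - 1;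
-- summing over i gives 1 = Σᵢ π i ≤ n k ^ (n - 1) π m.
module Submission where

open import Algebra.Bundles using (CommutativeMonoid)
open import Defs
open import Data.Fin as Fin using (Fin; zero; suc)
open import Data.Fin.Properties using (injective⇒≤)
open import Data.Integer as ℤ using (+_)
import Data.Integer.Properties as ℤ
open import Data.List as List using (List; []; _∷_)
open import Data.List.Membership.Propositional using (_∈_)
open import Data.List.Membership.Propositional.Properties using (∈-lookup)
import Data.List.Membership.DecPropositional as DecMembership
open import Data.List.Relation.Unary.All as All using ([])
open import Data.List.Relation.Unary.All.Properties using (¬Any⇒All¬)
open import Data.List.Relation.Unary.Any using (here; there)
open import Data.List.Relation.Unary.Unique.Propositional using (Unique; []; _∷_)
open import Data.Nat using (ℕ; zero; suc; NonZero; _^_; _∸_)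
import Data.Nat as ℕ
import Data.Nat.Properties as ℕ
open import Data.Product using (Σ-syntax; _,_; proj₁; proj₂)
open import Data.Rational using (ℚ; 0ℚ; 1ℚ; _/_; _*_; _+_; _≤_; toℚᵘ; fromℚᵘ; NonNegative; nonNegative)
open import Data.Rational.Properties
open import Algebra.Properties.CommutativeSemigroup
  (CommutativeMonoid.commutativeSemigroup *-1-commutativeMonoid) using (x∙yz≈y∙xz)
open import Data.Rational.Unnormalised as ℚᵘ using (mkℚᵘ; *≡*; *≤*)
  renaming (_*_ to _*ᵘ_; _+_ to _+ᵘ_; _≤_ to _≤ᵘ_)
import Data.Rational.Unnormalised.Properties as ℚᵘ
open import Function using (Injective)
open import Relation.Binary.PropositionalEquality
open import Relation.Nullary using (yes; no; contradiction)

fromℚᵘ-homo-* : ∀ p q → fromℚᵘ (p *ᵘ q) ≡ fromℚᵘ p * fromℚᵘ q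
fromℚᵘ-homo-* p q = toℚᵘ-injective (begin
  toℚᵘ (fromℚᵘ (p *ᵘ q))              ≈⟨ toℚᵘ-fromℚᵘ (p *ᵘ q) ⟩
  p *ᵘ q                              ≈⟨ ℚᵘ.*-cong (toℚᵘ-fromℚᵘ p) (toℚᵘ-fromℚᵘ q) ⟨
  toℚᵘ (fromℚᵘ p) *ᵘ toℚᵘ (fromℚᵘ q)  ≈⟨ toℚᵘ-homo-* (fromℚᵘ p) (fromℚᵘ q) ⟨
  toℚᵘ (fromℚᵘ p * fromℚᵘ q)          ∎)
  where open ℚᵘ.≃-Reasoning

fromℚᵘ-homo-+ : ∀ p q → fromℚᵘ (p +ᵘ q) ≡ fromℚᵘ p + fromℚᵘ q
fromℚᵘ-homo-+ p q = toℚᵘ-injective (begin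
  toℚᵘ (fromℚᵘ (p +ᵘ q))              ≈⟨ toℚᵘ-fromℚᵘ (p +ᵘ q) ⟩
  p +ᵘ q                              ≈⟨ ℚᵘ.+-cong (toℚᵘ-fromℚᵘ p) (toℚᵘ-fromℚᵘ q) ⟨
  toℚᵘ (fromℚᵘ p) +ᵘ toℚᵘ (fromℚᵘ q)  ≈⟨ toℚᵘ-homo-+ (fromℚᵘ p) (fromℚᵘ q) ⟨
  toℚᵘ (fromℚᵘ p + fromℚᵘ q)          ∎)
  where open ℚᵘ.≃-Reasoning

fromℚᵘ-mono-≤ : ∀ {p q} → p ≤ᵘ q → fromℚᵘ p ≤ fromℚᵘ q
fromℚᵘ-mono-≤ {p} {q} p≤q = toℚᵘ-cancel-≤ (begin
  toℚᵘ (fromℚᵘ p)  ≃⟨ toℚᵘ-fromℚᵘ p ⟩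
  p                ≤⟨ p≤q ⟩
  q                ≃⟨ toℚᵘ-fromℚᵘ q ⟨
  toℚᵘ (fromℚᵘ q)  ∎)
  where open ℚᵘ.≤-Reasoning

fromℕ : ℕ → ℚ
fromℕ a = + a / 1

fromℕ-homo-* : ∀ a b → fromℕ (a ℕ.* b) ≡ fromℕ a * fromℕ b
fromℕ-homo-* a b = trans
  (fromℚᵘ-cong {mkℚᵘ (+ (a ℕ.* b)) 0} {mkℚᵘ (+ a) 0 *ᵘ mkℚᵘ (+ b) 0} (*≡* (cong (ℤ._* + 1) (ℤ.pos-* a b))))
  (fromℚᵘ-homo-* (mkℚᵘ (+ a) 0) (mkℚᵘ (+ b) 0))

fromℕ-homo-+ : ∀ a b → fromℕ (a ℕ.+ b) ≡ fromℕ a + fromℕ b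
fromℕ-homo-+ a b = trans
  (fromℚᵘ-cong {mkℚᵘ (+ (a ℕ.+ b)) 0} {mkℚᵘ (+ a) 0 +ᵘ mkℚᵘ (+ b) 0} (*≡* (cong (ℤ._* + 1) pos-+)))
  (fromℚᵘ-homo-+ (mkℚᵘ (+ a) 0) (mkℚᵘ (+ b) 0))
  where
  pos-+ : + (a ℕ.+ b) ≡ + a ℤ.* + 1 ℤ.+ + b ℤ.* + 1
  pos-+ = trans (ℤ.pos-+ a b) (sym (cong₂ ℤ._+_ (ℤ.*-identityʳ (+ a)) (ℤ.*-identityʳ (+ b))))

fromℕ-mono-≤ : ∀ {a b} → a ℕ.≤ b → fromℕ a ≤ fromℕ b
fromℕ-mono-≤ {a} {b} a≤b =
  fromℚᵘ-mono-≤ {mkℚᵘ (+ a) 0} {mkℚᵘ (+ b) 0} (*≤* (ℤ.*-monoʳ-≤-nonNeg (+ 1) (ℤ.+≤+ a≤b)))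

fromℕ-nonNegative : ∀ a → NonNegative (fromℕ a)
fromℕ-nonNegative a = normalize-nonNeg a 1

fromℕ-*-/ : ∀ a k .{{_ : NonZero k}} → fromℕ k * (+ a / k) ≡ fromℕ a
fromℕ-*-/ a k@(suc k-1) = trans
  (sym (fromℚᵘ-homo-* (mkℚᵘ (+ k) 0) (mkℚᵘ (+ a) k-1)))
  (fromℚᵘ-cong {mkℚᵘ (+ k) 0 *ᵘ mkℚᵘ (+ a) k-1} {mkℚᵘ (+ a) 0} (*≡* cross))
  where
  open ≡-Reasoning
  cross : (+ k ℤ.* + a) ℤ.* + 1 ≡ + a ℤ.* + (1 ℕ.* k)
  cross = begin
    (+ k ℤ.* + a) ℤ.* + 1  ≡⟨ ℤ.*-identityʳ (+ k ℤ.* + a) ⟩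
    + k ℤ.* + a            ≡⟨ ℤ.*-comm (+ k) (+ a) ⟩
    + a ℤ.* + k            ≡⟨ cong (λ d → + a ℤ.* + d) (ℕ.*-identityˡ k) ⟨
    + a ℤ.* + (1 ℕ.* k)    ∎

1≤d*q⇒1/d≤q : ∀ d .{{_ : NonZero d}} {q} → 1ℚ ≤ fromℕ d * q → + 1 / d ≤ q
1≤d*q⇒1/d≤q d {q} 1≤dq = begin
  + 1 / d                  ≡⟨ *-identityʳ (+ 1 / d) ⟨
  + 1 / d * 1ℚ             ≤⟨ *-monoˡ-≤-nonNeg (+ 1 / d) {{normalize-nonNeg 1 d}} 1≤dq ⟩
  + 1 / d * (fromℕ d * q)  ≡⟨ *-assoc (+ 1 / d) (fromℕ d) q ⟨
  + 1 / d * fromℕ d * q    ≡⟨ cong (_* q) (trans (*-comm (+ 1 / d) (fromℕ d)) (fromℕ-*-/ 1 d)) ⟩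
  1ℚ * q                   ≡⟨ *-identityˡ q ⟩
  q                        ∎
  where open ≤-Reasoning

sumℚ-nonNeg : ∀ {n} (f : Fin n → ℚ) → (∀ i → 0ℚ ≤ f i) → 0ℚ ≤ sumℚ f
sumℚ-nonNeg {zero}  f f≥0 = ≤-refl
sumℚ-nonNeg {suc n} f f≥0 = +-mono-≤ (f≥0 zero) (sumℚ-nonNeg (λ i → f (suc i)) (λ i → f≥0 (suc i)))

term≤sumℚ : ∀ {n} (f : Fin n → ℚ) → (∀ i → 0ℚ ≤ f i) → ∀ j → f j ≤ sumℚ f
term≤sumℚ f f≥0 zero = begin
  f zero             ≡⟨ +-identityʳ (f zero) ⟨
  f zero + 0ℚ        ≤⟨ +-monoʳ-≤ (f zero) (sumℚ-nonNeg (λ i → f (suc i)) (λ i → f≥0 (suc i))) ⟩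
  sumℚ f             ∎
  where open ≤-Reasoning
term≤sumℚ f f≥0 (suc j) = begin
  f (suc j)                     ≤⟨ term≤sumℚ (λ i → f (suc i)) (λ i → f≥0 (suc i)) j ⟩
  sumℚ (λ i → f (suc i))        ≡⟨ +-identityˡ _ ⟨
  0ℚ + sumℚ (λ i → f (suc i))   ≤⟨ +-monoˡ-≤ (sumℚ (λ i → f (suc i))) (f≥0 zero) ⟩
  sumℚ f                        ∎
  where open ≤-Reasoning

sumℚ-mono-≤ : ∀ {n} {f g : Fin n → ℚ} → (∀ i → f i ≤ g i) → sumℚ f ≤ sumℚ g
sumℚ-mono-≤ {zero}  f≤g = ≤-refl
sumℚ-mono-≤ {suc n} f≤g = +-mono-≤ (f≤g zero) (sumℚ-mono-≤ (λ i → f≤g (suc i)))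

sumℚ-const : ∀ n c → sumℚ {n} (λ _ → c) ≡ fromℕ n * c
sumℚ-const zero    c = sym (*-zeroˡ c)
sumℚ-const (suc n) c = begin
  c + sumℚ {n} (λ _ → c)  ≡⟨ cong₂ _+_ (sym (*-identityˡ c)) (sumℚ-const n c) ⟩
  1ℚ * c + fromℕ n * c    ≡⟨ *-distribʳ-+ c 1ℚ (fromℕ n) ⟨
  (1ℚ + fromℕ n) * c      ≡⟨ cong (_* c) (fromℕ-homo-+ 1 n) ⟨
  fromℕ (suc n) * c       ∎
  where open ≡-Reasoning

lookup-injective : ∀ {a} {X : Set a} {xs : List X} → Unique xs → Injective _≡_ _≡_ (List.lookup xs)
lookup-injective (_   ∷ _)  {zero}  {zero}  _  = refl
lookup-injective (x∉ ∷ _)  {zero}  {suc j} eq = contradiction eq (All.lookup x∉ (∈-lookup j))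
lookup-injective (x∉ ∷ _)  {suc i} {zero}  eq = contradiction (sym eq) (All.lookup x∉ (∈-lookup i))
lookup-injective (_   ∷ u)  {suc i} {suc j} eq = cong suc (lookup-injective u eq)

Unique⇒length≤ : ∀ {m} {xs : List (Fin m)} → Unique xs → List.length xs ℕ.≤ m
Unique⇒length≤ u = injective⇒≤ (lookup-injective u)

module _ {n : ℕ} {A : Matrix n} where
  open DecMembership (Fin._≟_ {n}) using (_∈?_)

  length : ∀ {i j} → Walk A i j → ℕ
  length here       = 0
  length (step _ w) = suc (length w)

  vertices : ∀ {i j} → Walk A i j → List (Fin n)
  vertices (here {i})     = i ∷ []
  vertices (step {i} _ w) = i ∷ vertices w

  length-vertices : ∀ {i j} (w : Walk A i j) → List.length (vertices w) ≡ suc (length w)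
  length-vertices here       = refl
  length-vertices (step _ w) = cong suc (length-vertices w)

  IsPath : ∀ {i j} → Walk A i j → Set
  IsPath w = Unique (vertices w)

  suffix : ∀ {x j l} (w : Walk A j l) → IsPath w → x ∈ vertices w → Σ[ p ∈ Walk A x l ] IsPath p
  suffix w@here       w-path       (here refl) = w , w-path
  suffix w@(step _ _) w-path       (here refl) = w , w-path
  suffix (step _ w)   (_ ∷ w-path) (there x∈w) = suffix w w-path x∈w

  toPath : ∀ {i l} → Walk A i l → Σ[ p ∈ Walk A i l ] IsPath p
  toPath here = here , ([] ∷ [])
  toPath (step {i} A>0 w) with toPath w
  ... | p , p-path with i ∈? vertices p
  ...   | yes i∈p = suffix p p-path i∈p
  ...   | no  i∉p = step A>0 p , (¬Any⇒All¬ (vertices p) i∉p ∷ p-path)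

  path-length< : ∀ {i l} {p : Walk A i l} → IsPath p → length p ℕ.< n
  path-length< {p = p} p-path = subst (ℕ._≤ n) (length-vertices p) (Unique⇒length≤ p-path)

module _ {n k : ℕ} .{{_ : NonZero k}} {A : Matrix n} {π : Fin n → ℚ}
         (stationary : IsStationary k A π) where

  private
    π-nonNeg : ∀ i → NonNegative (π i)
    π-nonNeg i = nonNegative (proj₂ (proj₂ stationary) i)

    flow-nonNeg : ∀ j i → 0ℚ ≤ π i * P k A i j
    flow-nonNeg j i = nonNegative⁻¹ _
      {{nonNeg*nonNeg⇒nonNeg (π i) {{π-nonNeg i}} (P k A i j) {{normalize-nonNeg (A i j) k}}}}

  edge-≤ : ∀ {i j} → 0 ℕ.< A i j → π i ≤ fromℕ k * π j
  edge-≤ {i} {j} A>0 = begin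
    π i                                       ≡⟨ *-identityʳ (π i) ⟨
    π i * 1ℚ                                  ≤⟨ *-monoˡ-≤-nonNeg (π i) {{π-nonNeg i}} (fromℕ-mono-≤ A>0) ⟩
    π i * fromℕ (A i j)                       ≡⟨ cong (π i *_) (fromℕ-*-/ (A i j) k) ⟨
    π i * (fromℕ k * P k A i j)               ≡⟨ x∙yz≈y∙xz (π i) (fromℕ k) (P k A i j) ⟩
    fromℕ k * (π i * P k A i j)               ≤⟨ *-monoˡ-≤-nonNeg (fromℕ k) {{fromℕ-nonNegative k}}
                                                   (term≤sumℚ _ (flow-nonNeg j) i) ⟩
    fromℕ k * sumℚ (λ i′ → π i′ * P k A i′ j) ≡⟨ cong (fromℕ k *_) (proj₁ stationary j) ⟩
    fromℕ k * π j                             ∎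
    where open ≤-Reasoning

  walk-≤ : ∀ {i l} (w : Walk A i l) → π i ≤ fromℕ (k ^ length w) * π l
  walk-≤ {i} here = ≤-reflexive (sym (*-identityˡ (π i)))
  walk-≤ {i} {l} (step {j = j} A>0 w) = begin
    π i                                    ≤⟨ edge-≤ A>0 ⟩
    fromℕ k * π j                          ≤⟨ *-monoˡ-≤-nonNeg (fromℕ k) {{fromℕ-nonNegative k}} (walk-≤ w) ⟩
    fromℕ k * (fromℕ (k ^ length w) * π l) ≡⟨ *-assoc (fromℕ k) (fromℕ (k ^ length w)) (π l) ⟨
    fromℕ k * fromℕ (k ^ length w) * π l   ≡⟨ cong (_* π l) (fromℕ-homo-* k (k ^ length w)) ⟨
    fromℕ (k ^ suc (length w)) * π l       ∎
    where open ≤-Reasoning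

  connected-≤ : Connected A → ∀ i m → π i ≤ fromℕ (k ^ (n ∸ 1)) * π m
  connected-≤ connected i m = let p , p-path = toPath (connected i m) in begin
    π i                            ≤⟨ walk-≤ p ⟩
    fromℕ (k ^ length p) * π m     ≤⟨ *-monoʳ-≤-nonNeg (π m) {{π-nonNeg m}}
                                       (fromℕ-mono-≤ (ℕ.^-monoʳ-≤ k (ℕ.∸-monoˡ-≤ 1 (path-length< p-path)))) ⟩
    fromℕ (k ^ (n ∸ 1)) * π m      ∎
    where open ≤-Reasoning

  connected-1≤ : Connected A → ∀ m → 1ℚ ≤ fromℕ (n ℕ.* k ^ (n ∸ 1)) * π m
  connected-1≤ connected m = begin
    1ℚ                                     ≡⟨ proj₁ (proj₂ stationary) ⟨
    sumℚ π                                 ≤⟨ sumℚ-mono-≤ (λ i → connected-≤ connected i m) ⟩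
    sumℚ {n} (λ _ → fromℕ K * π m)         ≡⟨ sumℚ-const n (fromℕ K * π m) ⟩
    fromℕ n * (fromℕ K * π m)              ≡⟨ *-assoc (fromℕ n) (fromℕ K) (π m) ⟨
    fromℕ n * fromℕ K * π m                ≡⟨ cong (_* π m) (fromℕ-homo-* n K) ⟨
    fromℕ (n ℕ.* K) * π m                  ∎
    where
    open ≤-Reasoning
    K : ℕ
    K = k ^ (n ∸ 1)

lemma3p1 : (n k : ℕ) .{{_ : NonZero n}} .{{_ : NonZero k}} (A : Matrix n) →
    IsOrbigraph k A → Connected A →
    (π : Fin n → ℚ) → IsStationary k A π →
    (m : Fin n) → ((i : Fin n) → π m ≤ π i) →
    bound n k ≤ π m
lemma3p1 n k {{n≢0}} A _ connected π stationary m _ =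
  1≤d*q⇒1/d≤q (n ℕ.* k ^ (n ∸ 1)) {{ℕ.m*n≢0 n (k ^ (n ∸ 1)) {{n≢0}} {{ℕ.m^n≢0 k (n ∸ 1)}}}}
    (connected-1≤ stationary connected m)
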